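{- Let $G$ be a finite simple graph, let $t$ be a trivial coloring of $G$ (every vertex receives a different color), and let $c$ be any acyclic coloring of $G$. Then there exist acyclic colorings $c_1,\dots,c_{\ell-1}$ of $G$ such that $$c\triangleleft_a c_1\triangleleft_a c_2\triangleleft_a\cdots\triangleleft_a c_{\ell-1}\triangleleft_a t.$$
   Context: All graphs are finite and simple. A (proper) $k$-coloring of $G$ is a map $c:V(G)\to[k]=\{1,\dots,k\}$ with $c(x)\neq c(y)$ for every edge $xy$; its color classes are $V_i=c^{ -1}(i)$. For colors $i,j$ put $V_{i,j}=V_i\cup V_j$. A coloring is acyclic if $G[V_{i,j}]$ is a forest for all colors $i,j$. Let $CN_c(v)=\{c(u):u\in N_G(v)\}$ and $CN_c[v]=CN_c(v)\cup\{c(v)\}$. A vertex $v$ is a b-vertex of a coloring $c$ using colors $[k]$ if $CN_c[v]=[k]$. A recoloring step: given a $k$-coloring $c$ and a color $i$ such that no vertex of color $i$ is a b-vertex, form the coloring $c'$ that agrees with $c$ outside $V_i$ and gives every $v\in V_i$ some color $j_v\in[k]\setminus CN_c[v]$; then $c'$ uses the $k-1$ colors $[k]\setminus\{i\}$. If $c$ and $c'$ are both acyclic, this is an acyclic recoloring step and we write $c'\triangleleft_a c$. -}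

module Defs where

open import Data.Nat using (ℕ; zero; suc; _≥_)
open import Data.Fin using (Fin)
open import Data.Bool using (Bool; true; false)
open import Data.List using (List; []; _∷_; _++_; [_]; length)
open import Data.List.Relation.Unary.All using (All)
open import Data.List.Relation.Unary.Unique.Propositional using (Unique)
open import Data.Product using (Σ; ∃; _×_; _,_)
open import Data.Sum using (_⊎_)
open import Data.Unit using (⊤)
open import Data.Empty using (⊥)
open import Relation.Nullary using (¬_)
open import Relation.Binary.PropositionalEquality using (_≡_; _≢_)
open import Function.Definitions using (Injective)

record Graph (n : ℕ) : Set where
  field
    adj   : Fin n → Fin n → Bool
    sym   : ∀ x y → adj x y ≡ adj y x
    irrefl : ∀ x → adj x x ≡ false

module _ {n : ℕ} (G : Graph n) where
  open Graph G

  Edge : Fin n → Fin n → Set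
  Edge x y = adj x y ≡ true

  Walk : List (Fin n) → Set
  Walk [] = ⊤
  Walk (x ∷ []) = ⊤
  Walk (x ∷ y ∷ r) = Edge x y × Walk (y ∷ r)

  IsCycle : List (Fin n) → Set
  IsCycle [] = ⊥
  IsCycle (x ∷ r) = (length (x ∷ r) ≥ 3) × Unique (x ∷ r) × Walk ((x ∷ r) ++ [ x ])

  Forest : (Fin n → Set) → Set
  Forest S = ∀ (cyc : List (Fin n)) → IsCycle cyc → ¬ All S cyc

  Coloring : ℕ → Set
  Coloring k = Fin n → Fin k

  Proper : ∀ {k} → Coloring k → Set
  Proper c = ∀ x y → Edge x y → c x ≢ c y

  V₂ : ∀ {k} → Coloring k → Fin k → Fin k → Fin n → Set
  V₂ c i j v = (c v ≡ i) ⊎ (c v ≡ j)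

  Acyclic : ∀ {k} → Coloring k → Set
  Acyclic c = Proper c × (∀ i j → Forest (V₂ c i j))

  InCN : ∀ {k} → Coloring k → Fin n → Fin k → Set
  InCN c v j = ∃ λ u → Edge v u × c u ≡ j

  InCN[] : ∀ {k} → Coloring k → Fin n → Fin k → Set
  InCN[] c v j = (c v ≡ j) ⊎ InCN c v j

  BVertex : ∀ {k} → Coloring k → Fin n → Set
  BVertex c v = ∀ j → InCN[] c v j

  UsesAllColors : ∀ {k} → Coloring k → Set
  UsesAllColors c = ∀ j → ∃ λ v → c v ≡ j

  Trivial : Coloring n → Set
  Trivial t = Injective _≡_ _≡_ t

  -- Acyclic recoloring step  c' ◁ₐ c  where c is a (k+1)-coloring.
  -- The color set [k+1] \ {i} of c' is identified with [k] via a
  -- renaming σ : Fin k → Fin (suc k), injective with image avoiding i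
  -- (hence image exactly [k+1] \ {i}).
  record Step {k : ℕ} (c' : Coloring k) (c : Coloring (suc k)) : Set where
    field
      i       : Fin (suc k)
      no-b    : ∀ v → c v ≡ i → ¬ BVertex c v
      σ       : Fin k → Fin (suc k)
      σ-inj   : Injective _≡_ _≡_ σ
      σ-avoid : ∀ j → σ j ≢ i
      keep    : ∀ v → c v ≢ i → σ (c' v) ≡ c v
      recolor : ∀ v → c v ≡ i → ¬ InCN[] c v (σ (c' v))
      acyc    : Acyclic c
      acyc'   : Acyclic c'

  Renaming : ∀ {k} → Coloring k → Coloring k → Set
  Renaming {k} c d = Σ (Fin k → Fin k) λ π → Injective _≡_ _≡_ π × (∀ v → π (c v) ≡ d v)

  data Chain : ∀ {k m} → Coloring k → Coloring m → Set where
    base : ∀ {k} {c d : Coloring k} → Renaming c d → Chain c d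
    step : ∀ {k m} {c' : Coloring k} {c : Coloring (suc k)} {d : Coloring m} →
           Step c' c → Chain c d → Chain c' d

{-# OPTIONS --safe #-}
module Submission where

-- Read the chain from t down to c backwards: undoing a recoloring step means giving one
-- vertex v of a repeated color a fresh color. The old coloring is then a coarsening of the
-- new one, so properness and acyclicity carry over, and v is not a b-vertex of the new
-- coloring because its old color is missing from its closed neighbourhood (its neighbours
-- had different old colors). By pigeonhole this can be repeated until all n colors are used;
-- such a coloring is injective, hence equal to t up to a renaming of colors.

open import Data.Nat using (ℕ; zero; suc; _+_; _∸_; _≤_; _<_; s≤s)
open import Data.Nat.Properties using (+-suc; m∸n+n≡m; m≤n+m; 1+n≰n; ≤-trans; ≤-reflexive)
open import Data.Fin using (Fin; zero; suc; _≟_)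
open import Data.Fin.Properties using (suc-injective; injective⇒≤; pigeonhole; <⇒≢)
open import Data.List.Relation.Unary.All as All using ()
open import Data.Product using (∃₂; _×_; _,_; proj₁; proj₂)
open import Data.Sum as Sum using (inj₁; inj₂)
open import Data.Empty using (⊥-elim)
open import Function using (_∘_)
open import Function.Definitions using (Injective)
open import Relation.Nullary using (¬_; yes; no)
open import Relation.Binary.PropositionalEquality using (_≡_; _≢_; refl; sym; trans; cong)
open import Defs

module _ {n : ℕ} (G : Graph n) where

  forest-mono : ∀ {S T : Fin n → Set} → (∀ {u} → S u → T u) → Forest G T → Forest G S
  forest-mono S⊆T forestT cyc isCycle = forestT cyc isCycle ∘ All.map S⊆T

  module Coarsening {k m} {c : Coloring G k} {d : Coloring G m}
                    (f : Fin m → Fin k) (c≡f∘d : ∀ u → c u ≡ f (d u)) where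

    proper-refine : Proper G c → Proper G d
    proper-refine proper x y e dx≡dy =
      proper x y e (trans (c≡f∘d x) (trans (cong f dx≡dy) (sym (c≡f∘d y))))

    V₂-refine : ∀ i j {u} → V₂ G d i j u → V₂ G c (f i) (f j) u
    V₂-refine i j {u} = Sum.map refine refine
      where
        refine : ∀ {a} → d u ≡ a → c u ≡ f a
        refine e = trans (c≡f∘d u) (cong f e)

    acyclic-refine : Acyclic G c → Acyclic G d
    acyclic-refine (proper , forest) =
      proper-refine proper , λ i j → forest-mono (V₂-refine i j) (forest (f i) (f j))

  module FreshColor {k} (c : Coloring G k) (v : Fin n) where

    fresh : Coloring G (suc k)
    fresh u with u ≟ v
    ... | yes _ = zero
    ... | no _  = suc (c u)

    merge : Fin (suc k) → Fin k
    merge zero    = c v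
    merge (suc a) = a

    fresh-self : fresh v ≡ zero
    fresh-self with v ≟ v
    ... | yes _   = refl
    ... | no v≢v = ⊥-elim (v≢v refl)

    fresh-other : ∀ {u} → u ≢ v → fresh u ≡ suc (c u)
    fresh-other {u} u≢v with u ≟ v
    ... | yes u≡v = ⊥-elim (u≢v u≡v)
    ... | no _    = refl

    c≡merge∘fresh : ∀ u → c u ≡ merge (fresh u)
    c≡merge∘fresh u with u ≟ v
    ... | yes refl = refl
    ... | no _     = refl

    fresh-acyclic : Acyclic G c → Acyclic G fresh
    fresh-acyclic = Coarsening.acyclic-refine merge c≡merge∘fresh

    fresh-usesAllColors : UsesAllColors G c → ∀ {w} → w ≢ v → c w ≡ c v → UsesAllColors G fresh
    fresh-usesAllColors uses w≢v cw≡cv zero = v , fresh-self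
    fresh-usesAllColors uses {w} w≢v cw≡cv (suc a) with uses a
    ... | u , cu≡a with u ≟ v
    ...   | yes refl = w , trans (fresh-other w≢v) (cong suc (trans cw≡cv cu≡a))
    ...   | no u≢v   = u , trans (fresh-other u≢v) (cong suc cu≡a)

    fresh-keeps-old-color : ∀ u → fresh u ≢ zero → suc (c u) ≡ fresh u
    fresh-keeps-old-color u fu≢0 with u ≟ v
    ... | yes _    = ⊥-elim (fu≢0 refl)
    ... | no _     = refl

    old-color-∉-CN[fresh] : Proper G c → ∀ u → fresh u ≡ zero → ¬ InCN[] G fresh u (suc (c u))
    old-color-∉-CN[fresh] proper u fu≡0 (inj₁ fu≡1+cu) with trans (sym fu≡0) fu≡1+cu
    ... | ()
    old-color-∉-CN[fresh] proper u fu≡0 (inj₂ (w , e , fw≡1+cu)) =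
      proper u w e (sym (trans (c≡merge∘fresh w) (cong merge fw≡1+cu)))

    fresh-step : Acyclic G c → Step G c fresh
    fresh-step acyclic = record
      { i       = zero
      ; no-b    = λ u fu≡0 isB → old-color-∉-CN[fresh] (proj₁ acyclic) u fu≡0 (isB (suc (c u)))
      ; σ       = suc
      ; σ-inj   = suc-injective
      ; σ-avoid = λ _ ()
      ; keep    = fresh-keeps-old-color
      ; recolor = old-color-∉-CN[fresh] (proj₁ acyclic)
      ; acyc    = fresh-acyclic acyclic
      ; acyc'   = acyclic
      }

  module _ {k} {c : Coloring G k} (uses : UsesAllColors G c) where

    representative : Fin k → Fin n
    representative a = proj₁ (uses a)

    representative-injective : Injective _≡_ _≡_ representative
    representative-injective {a} {b} e =
      trans (sym (proj₂ (uses a))) (trans (cong c e) (proj₂ (uses b)))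

    usesAllColors⇒≤ : k ≤ n
    usesAllColors⇒≤ = injective⇒≤ representative-injective

  repeated-color : ∀ {k} (c : Coloring G k) → k < n → ∃₂ λ w v → w ≢ v × c w ≡ c v
  repeated-color c k<n with pigeonhole k<n c
  ... | w , v , w<v , cw≡cv = w , v , <⇒≢ w<v , cw≡cv

  -- If two vertices shared a color, a fresh color would give n + 1 colors on n vertices.
  usesAllColors⇒injective : (c : Coloring G n) → UsesAllColors G c → Injective _≡_ _≡_ c
  usesAllColors⇒injective c uses {x} {y} cx≡cy with x ≟ y
  ... | yes x≡y = x≡y
  ... | no x≢y  = ⊥-elim (1+n≰n (usesAllColors⇒≤ (FreshColor.fresh-usesAllColors c y uses x≢y cx≡cy)))

  renaming-to-trivial : (c : Coloring G n) → UsesAllColors G c → (t : Coloring G n) → Trivial G t →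
                        Renaming G c t
  renaming-to-trivial c uses t t-injective =
    t ∘ representative uses ,
    representative-injective uses ∘ t-injective ,
    λ v → cong t (usesAllColors⇒injective c uses (proj₂ (uses (c v))))

  chain-to-trivial : (t : Coloring G n) → Trivial G t → (gap : ℕ) → ∀ {k} (c : Coloring G k) →
                     gap + k ≡ n → Acyclic G c → UsesAllColors G c → Chain G c t
  chain-to-trivial t t-injective zero c refl acyclic uses =
    base (renaming-to-trivial c uses t t-injective)
  chain-to-trivial t t-injective (suc gap) {k} c gap+k+1≡n acyclic uses
    with repeated-color c (≤-trans (s≤s (m≤n+m k gap)) (≤-reflexive gap+k+1≡n))
  ... | w , v , w≢v , cw≡cv =
    step (fresh-step acyclic)
         (chain-to-trivial t t-injective gap fresh (trans (+-suc gap k) gap+k+1≡n)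
                           (fresh-acyclic acyclic) (fresh-usesAllColors uses w≢v cw≡cv))
    where open FreshColor c v

proposition2 : ∀ {n : ℕ} (G : Graph n) (t : Coloring G n) → Trivial G t →
    ∀ {k : ℕ} (c : Coloring G k) → Acyclic G c → UsesAllColors G c → Chain G c t
proposition2 {n} G t t-injective {k} c acyclic uses =
  chain-to-trivial G t t-injective (n ∸ k) c (m∸n+n≡m (usesAllColors⇒≤ G uses)) acyclic uses
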